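{- Let $U$ be a sunshine graph and $T$ a caterpillar of order $n$ with $b(U,T)\ge 5$, and let $U^+$ be a sunshine supercard of $U$ and $T$ (with $w,v$, labelling and $\chi$ as in the context) chosen so that $\chi(U^+)$ is largest possible among all sunshine supercards of $U$ and $T$. Suppose $\mathrm{Aut}(U^+)$ contains a non-trivial rotation. Let $A$ be the set of integers $\beta$ such that $x_\beta=\lambda(x_0)$ for some rotation $\lambda\in\mathrm{Aut}(U^+)$, and let $\delta$ be the smallest positive element of $A$. Then (a) $\delta$ divides every element of $A$; (b) $2\le\delta\le\frac{c}{2}$; (c) there exists a rotation $\phi\in\mathrm{Aut}(U^+)$ such that $\phi^{c/\delta}$ is the identity, $\phi(x_i)=x_{\delta+i}$ and $\phi(x_i^j)=x_{\delta+i}^j$ for all $i,j$.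
   Context: All graphs are finite and simple. The deck of $G$ is the multiset of unlabelled cards $G-v$; $b(G,H)$ is the cardinality of the multiset intersection of the decks. The skeleton of a graph is obtained by deleting all vertices of degree $0$ or $1$; sunshine graph: connected, skeleton a cycle; caterpillar: connected, skeleton a path. A supercard of $U$ and $T$ is a graph of order $n+1$ whose deck contains cards isomorphic to $U$ and to $T$. For a sunshine supercard $U^+$, fix $w,v$ with $U^+-w\cong U$, $U^+-v\cong T$ ($w$ a leaf, $v$ a degree-2 cycle vertex); identify $U=U^+-w$, $T=U^+-v$. Label the cycle $x_0\ldots x_{c-1}x_0$ (indices are integers taken mod $c$) with $x_0$ adjacent to $w$, $v=x_\nu$, $d_{U^+}(x_{\nu-1})\ge d_{U^+}(x_{\nu+1})$; the leaves adjacent to $x_i$ are labelled $x_i^j$, $1\le j\le d_{U^+}(x_i)-2$, with $w=x_0^1$. Write $\lambda(G)=H$ if the bijection $\lambda$ is an isomorphism from $G$ onto $H$. $B_{vw}(U^+)=\{\lambda\in\mathrm{Sym}(V(U^+)):\lambda(U-\lambda^{ -1}(v))=T-\lambda(w)\}$, $B_U=\{\lambda\in B_{vw}(U^+):\lambda(U)=U^+-\lambda(w)\}$. A maximum saturating set is $X\subseteq B_{vw}(U^+)$ with: the identity in $X$; distinct $\lambda,\pi\in X$ have $\lambda^{ -1}(v)\ne\pi^{ -1}(v)$ and $\lambda(w)\ne\pi(w)$; and no $\sigma\in B_{vw}(U^+)\setminus X$ can be added keeping the previous property. $\chi(U^+)=\max|X\cap B_U|$. Every automorphism of $U^+$ maps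 the cycle to itself; it is a rotation if $\lambda(x_i)=x_{\alpha+i}$ for all $i$ (some fixed $\alpha$), a reflection if $\lambda(x_i)=x_{\alpha-i}$ for all $i$; a rotation is non-trivial if $\lambda(x_0)\ne x_0$. -}

module Defs where

open import Data.Bool using (Bool; true; false; if_then_else_)
open import Data.Nat as ℕ using (ℕ; zero; suc; _∸_; _≤_; _<_)
open import Data.Integer as ℤ using (ℤ; +_)
open import Data.Integer.DivMod using (_%ℕ_; n%ℕd<d)
open import Data.Fin using (Fin; toℕ; fromℕ<; punchIn)
open import Data.Fin.Permutation using (Permutation′; _⟨$⟩ʳ_; _⟨$⟩ˡ_)
open import Data.Nat.ListAction using (sum)
open import Data.List using (List; map; allFin; length; lookup)
open import Data.List.Relation.Unary.All using (All)
open import Data.List.Relation.Unary.Any using (Any)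
open import Data.Product using (Σ; ∃; _×_; _,_)
open import Data.Sum using (_⊎_)
open import Function.Definitions using (Injective)
open import Function.Bundles using (_⇔_)
open import Relation.Nullary using (¬_)
open import Relation.Binary.PropositionalEquality using (_≡_; _≢_; refl; trans; sym)

record Graph (n : ℕ) : Set where
  field
    adj     : Fin n → Fin n → Bool
    adj-sym : ∀ a b → adj a b ≡ adj b a
    adj-irr : ∀ a → adj a a ≡ false
open Graph public

Adj : ∀ {n} → Graph n → Fin n → Fin n → Set
Adj G a b = adj G a b ≡ true

deg : ∀ {n} → Graph n → Fin n → ℕ
deg {n} G a = sum (map (λ b → if adj G a b then 1 else 0) (allFin n))

data Reach {n} (G : Graph n) : Fin n → Fin n → Set where
  here : ∀ {a} → Reach G a a
  step : ∀ {a b c} → Adj G a b → Reach G b c → Reach G a c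

Connected : ∀ {n} → Graph n → Set
Connected {n} G = ∀ (a b : Fin n) → Reach G a b

_≅_ : ∀ {n} → Graph n → Graph n → Set
_≅_ {n} G H = Σ (Permutation′ n) λ π →
  ∀ a b → adj G a b ≡ adj H (π ⟨$⟩ʳ a) (π ⟨$⟩ʳ b)

_─_ : ∀ {n} → Graph (suc n) → Fin (suc n) → Graph n
G ─ v = record
  { adj     = λ a b → adj G (punchIn v a) (punchIn v b)
  ; adj-sym = λ a b → adj-sym G (punchIn v a) (punchIn v b)
  ; adj-irr = λ a → adj-irr G (punchIn v a)
  }

-- b(G,H) ≥ k : the multiset intersection of the decks has at least k
-- elements, i.e. k cards of G can be matched injectively with k cards
-- of H such that matched cards are isomorphic.
DeckMeetAtLeast : ∀ {n} → ℕ → Graph (suc n) → Graph (suc n) → Set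
DeckMeetAtLeast {n} k G H =
  Σ (Fin k → Fin (suc n)) λ f → Σ (Fin k → Fin (suc n)) λ g →
    Injective _≡_ _≡_ f × Injective _≡_ _≡_ g × (∀ i → (G ─ f i) ≅ (H ─ g i))

idx : (c : ℕ) → 3 ≤ c → ℤ → Fin c
idx (suc c) _ i = fromℕ< (n%ℕd<d i (suc c))

-- x is a labelling x_0 … x_{c-1} of the skeleton of G as a cycle:
-- x is injective, its image is exactly the set of vertices of degree ≥ 2
-- (the skeleton), and the subgraph induced on the skeleton is the cycle
-- x_0 x_1 … x_{c-1} x_0.
IsCycleLab : ∀ {n} → Graph n → (c : ℕ) → 3 ≤ c → (Fin c → Fin n) → Set
IsCycleLab {n} G c h x =
  Injective _≡_ _≡_ x
  × (∀ (a : Fin n) → (2 ≤ deg G a) ⇔ (∃ λ i → x i ≡ a))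
  × (∀ (i j : Fin c) → Adj G (x i) (x j) ⇔
        (idx c h (+ toℕ i ℤ.+ + 1) ≡ j ⊎ idx c h (+ toℕ j ℤ.+ + 1) ≡ i))

Sunshine : ∀ {n} → Graph n → Set
Sunshine {n} G = Connected G ×
  Σ ℕ λ c → Σ (3 ≤ c) λ h → Σ (Fin c → Fin n) λ x → IsCycleLab G c h x

Caterpillar : ∀ {n} → Graph n → Set
Caterpillar {n} G = Connected G ×
  Σ ℕ λ p → Σ (Fin p → Fin n) λ y →
    Injective _≡_ _≡_ y
    × (∀ (a : Fin n) → (2 ≤ deg G a) ⇔ (∃ λ i → y i ≡ a))
    × (∀ (i j : Fin p) → Adj G (y i) (y j) ⇔
          (suc (toℕ i) ≡ toℕ j ⊎ suc (toℕ j) ≡ toℕ i))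

ValidWV : ∀ {n} → Graph (suc n) → Graph (suc n) → Graph (suc (suc n))
        → Fin (suc (suc n)) → Fin (suc (suc n)) → Set
ValidWV U T G w v =
  (G ─ w) ≅ U × (G ─ v) ≅ T × deg G w ≡ 1 × deg G v ≡ 2

Perm : ℕ → Set
Perm m = Permutation′ m

-- λ ∈ B_vw(U⁺):  λ(U - λ⁻¹(v)) = T - λ(w)  (as labelled graphs),
-- where U = U⁺ - w, T = U⁺ - v.
InBvw : ∀ {m} → Graph m → Fin m → Fin m → Perm m → Set
InBvw G w v π =
  (π ⟨$⟩ˡ v ≢ w)
  × (∀ a b → a ≢ w → a ≢ π ⟨$⟩ˡ v → b ≢ w → b ≢ π ⟨$⟩ˡ v →
       adj G a b ≡ adj G (π ⟨$⟩ʳ a) (π ⟨$⟩ʳ b))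

-- λ(U) = U⁺ - λ(w)
InBU : ∀ {m} → Graph m → Fin m → Perm m → Set
InBU G w π =
  ∀ a b → a ≢ w → b ≢ w → adj G a b ≡ adj G (π ⟨$⟩ʳ a) (π ⟨$⟩ʳ b)

_≗ₚ_ : ∀ {m} → Perm m → Perm m → Set
π ≗ₚ σ = ∀ a → π ⟨$⟩ʳ a ≡ σ ⟨$⟩ʳ a

IsId : ∀ {m} → Perm m → Set
IsId π = ∀ a → π ⟨$⟩ʳ a ≡ a

-- A finite set X ⊆ Sym(V) is represented by a list of permutations;
-- the pairwise condition forces distinct positions to hold distinct
-- permutations, so the list is duplicate-free.
Conflict : ∀ {m} → Fin m → Fin m → Perm m → Perm m → Set
Conflict w v π σ = (π ⟨$⟩ˡ v ≡ σ ⟨$⟩ˡ v) ⊎ (π ⟨$⟩ʳ w ≡ σ ⟨$⟩ʳ w)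

MaxSatSet : ∀ {m} → Graph m → Fin m → Fin m → List (Perm m) → Set
MaxSatSet G w v X =
  All (InBvw G w v) X
  × Any IsId X
  × (∀ (i j : Fin (length X)) → i ≢ j → ¬ Conflict w v (lookup X i) (lookup X j))
  × (∀ σ → InBvw G w v σ → (∀ i → ¬ (σ ≗ₚ lookup X i)) →
       ∃ λ i → Conflict w v σ (lookup X i))

-- χ(U⁺) ≥ k : some maximum saturating set X has |X ∩ B_U| ≥ k
ChiAtLeast : ∀ {m} → Graph m → Fin m → Fin m → ℕ → Set
ChiAtLeast {m} G w v k =
  Σ (List (Perm m)) λ X → MaxSatSet G w v X ×
    Σ (Fin k → Fin (length X)) λ f →
      Injective _≡_ _≡_ f × (∀ i → InBU G w (lookup X (f i)))

IsAut : ∀ {m} → Graph m → Perm m → Set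
IsAut G π = ∀ a b → adj G a b ≡ adj G (π ⟨$⟩ʳ a) (π ⟨$⟩ʳ b)

cyc : ∀ {m} (c : ℕ) → 3 ≤ c → (Fin c → Fin m) → ℤ → Fin m
cyc c h x i = x (idx c h i)

IsRotation : ∀ {m} → Graph m → (c : ℕ) → 3 ≤ c → (Fin c → Fin m) → Perm m → Set
IsRotation G c h x π =
  IsAut G π × Σ ℤ λ α → ∀ (i : ℤ) → π ⟨$⟩ʳ cyc c h x i ≡ cyc c h x (α ℤ.+ i)

InA : ∀ {m} → Graph m → (c : ℕ) → 3 ≤ c → (Fin c → Fin m) → ℤ → Set
InA G c h x β = Σ (Perm _) λ π →
  IsRotation G c h x π × cyc c h x β ≡ π ⟨$⟩ʳ cyc c h x (+ 0)

-- labelling of the leaves: leaf i j _ is x_i^{j+1}, 0 ≤ j < d(x_i) - 2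
IsLeafLab : ∀ {m} → (G : Graph m) → (c : ℕ) → (x : Fin c → Fin m) →
  ((i : Fin c) (j : ℕ) → j < deg G (x i) ∸ 2 → Fin m) → Set
IsLeafLab {m} G c x leaf =
  (∀ i j p → Adj G (x i) (leaf i j p))
  × (∀ i j p k → leaf i j p ≢ x k)
  × (∀ i j p i′ j′ p′ → leaf i j p ≡ leaf i′ j′ p′ → i ≡ i′ × j ≡ j′)
  × (∀ i (a : Fin m) → Adj G (x i) a → (∀ k → a ≢ x k) →
       Σ ℕ λ j → Σ (j < deg G (x i) ∸ 2) λ p → leaf i j p ≡ a)

iter : ∀ {m} → Perm m → ℕ → Fin m → Fin m
iter π zero a = a
iter π (suc k) a = π ⟨$⟩ʳ iter π k a

-- A rotation of U⁺ shifting the cycle by s makes the degrees along the cycle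
-- s-periodic; conversely, for every such shift s the map x_i ↦ x_{s+i},
-- x_i^j ↦ x_{s+i}^j is an automorphism, because every vertex off the cycle is a
-- leaf hanging at a single cycle vertex. So A, the set of shifts of rotations,
-- is closed under addition and negation and contains c; its least positive
-- element δ divides all of A, in particular c. A non-trivial rotation gives
-- δ < c, hence 2δ ≤ c, and δ = 1 would give all cycle vertices the degree of x₀,
-- which carries the leaf w, whereas v has degree 2. The canonical rotation by δ
-- is φ, and φ^{c/δ} shifts by c ≡ 0.
module Submission where

open import Defs
open import Data.Bool using (Bool; false; if_then_else_)
open import Data.Bool.Properties using (¬-not)
open import Data.Empty using (⊥-elim)
open import Data.Fin using (Fin; zero; suc; toℕ; _≟_)
open import Data.Fin.Permutation using (Permutation′; _⟨$⟩ʳ_; _⟨$⟩ˡ_; permutation; flip; _∘ₚ_; inverseʳ; inverseˡ) renaming (id to idₚ)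
open import Data.Fin.Properties using (toℕ<n; toℕ-injective; toℕ-fromℕ<; any?)
open import Data.Integer as ℤ using (ℤ; +_; +[1+_]; -[1+_])
import Data.Integer.Properties as ℤP
open import Data.Integer.DivMod using (a≡a%ℕn+[a/ℕn]*n; n%ℕd<d)
open import Data.Integer.Divisibility using (_∣_)
open import Data.Integer.Tactic.RingSolver using (solve-∀)
open import Data.List using (map; allFin; tabulate)
open import Data.List.Properties using (map-tabulate)
open import Data.Nat as ℕ using (ℕ; zero; suc; _≤_; _<_; _∸_)
import Data.Nat.Properties as ℕP
import Data.Nat.DivMod as ℕD
import Data.Nat.Divisibility as ℕ∣
open import Data.Nat.ListAction using (sum)
open import Data.Product using (Σ; ∃; _×_; _,_; proj₁; proj₂)
open import Data.Sum using (_⊎_; inj₁; inj₂)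
open import Function using (_∘_)
open import Function.Bundles using (Equivalence)
open import Relation.Binary.PropositionalEquality
open import Relation.Nullary using (¬_; yes; no; does)
import Algebra.Properties.CommutativeMonoid.Sum as CommutativeMonoidSum

module Degree where

  open import Data.Nat using (_+_)
  private
    module Σℕ = CommutativeMonoidSum ℕP.+-0-commutativeMonoid

  indicator : Bool → ℕ
  indicator b = if b then 1 else 0

  sum-allFin : ∀ {n} (f : Fin n → ℕ) → sum (map f (allFin n)) ≡ Σℕ.sum f
  sum-allFin f = trans (cong sum (map-tabulate (λ i → i) f)) (sum-tabulate f)
    where
    sum-tabulate : ∀ {n} (f : Fin n → ℕ) → sum (tabulate f) ≡ Σℕ.sum f
    sum-tabulate {zero}  f = refl
    sum-tabulate {suc n} f = cong (_+_ (f zero)) (sum-tabulate (λ i → f (suc i)))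

  deg≡sum : ∀ {n} (G : Graph n) a → deg G a ≡ Σℕ.sum (λ b → indicator (adj G a b))
  deg≡sum G a = sum-allFin (λ b → indicator (adj G a b))

  aut-preserves-deg : ∀ {n} (G : Graph n) (π : Permutation′ n) → IsAut G π →
                      ∀ a → deg G (π ⟨$⟩ʳ a) ≡ deg G a
  aut-preserves-deg G π aut a = begin
    deg G (π ⟨$⟩ʳ a)                                          ≡⟨ deg≡sum G _ ⟩
    Σℕ.sum (λ b → indicator (adj G (π ⟨$⟩ʳ a) b))             ≡⟨ Σℕ.sum-permute _ π ⟩
    Σℕ.sum (λ b → indicator (adj G (π ⟨$⟩ʳ a) (π ⟨$⟩ʳ b)))    ≡⟨ Σℕ.sum-cong-≗ (λ b → cong indicator (aut a b)) ⟨
    Σℕ.sum (λ b → indicator (adj G a b))                      ≡⟨ deg≡sum G a ⟨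
    deg G a                                                   ∎
    where open ≡-Reasoning

  ≤-sum : ∀ {n} (f : Fin n → ℕ) b → f b ≤ Σℕ.sum f
  ≤-sum f zero    = ℕP.m≤m+n _ _
  ≤-sum f (suc b) = ℕP.≤-trans (≤-sum (λ i → f (suc i)) b) (ℕP.m≤n+m _ _)

  +≤-sum : ∀ {n} (f : Fin n → ℕ) {b b′} → b ≢ b′ → f b + f b′ ≤ Σℕ.sum f
  +≤-sum f {zero}  {zero}   b≢b′ = ⊥-elim (b≢b′ refl)
  +≤-sum f {zero}  {suc b′} _    = ℕP.+-monoʳ-≤ (f zero) (≤-sum (λ i → f (suc i)) b′)
  +≤-sum f {suc b} {zero}   _    =
    subst (_≤ Σℕ.sum f) (ℕP.+-comm (f zero) _) (ℕP.+-monoʳ-≤ (f zero) (≤-sum (λ i → f (suc i)) b))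
  +≤-sum f {suc b} {suc b′} b≢b′ =
    ℕP.≤-trans (+≤-sum (λ i → f (suc i)) (λ e → b≢b′ (cong suc e))) (ℕP.m≤n+m _ _)

  two-neighbours⇒2≤deg : ∀ {n} (G : Graph n) {a b b′} →
                         Adj G a b → Adj G a b′ → b ≢ b′ → 2 ≤ deg G a
  two-neighbours⇒2≤deg G {a} ab ab′ b≢b′ = subst (2 ≤_) (sym (deg≡sum G a))
    (subst₂ (λ u v → u + v ≤ _) (cong indicator ab) (cong indicator ab′)
      (+≤-sum (λ b → indicator (adj G a b)) b≢b′))

open Degree using (aut-preserves-deg; two-neighbours⇒2≤deg)

∣∧<⇒2*≤ : ∀ {d n} → d ℕ∣.∣ n → d < n → 2 ℕ.* d ≤ n
∣∧<⇒2*≤ (ℕ∣.divides zero n≡0) d<n = ⊥-elim (ℕP.n≮0 (subst (_ <_) n≡0 d<n))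
∣∧<⇒2*≤ (ℕ∣.divides (suc zero) n≡d+0) d<n =
  ⊥-elim (ℕP.<⇒≢ d<n (trans (sym (ℕP.+-identityʳ _)) (sym n≡d+0)))
∣∧<⇒2*≤ {d} (ℕ∣.divides (suc (suc k)) n≡kd) _ =
  subst (2 ℕ.* d ≤_) (sym n≡kd) (ℕP.*-monoˡ-≤ d {2} {suc (suc k)} (ℕ.s≤s (ℕ.s≤s ℕ.z≤n)))

module Congruence where

  open import Data.Integer using (_+_; _*_; -_)

  infix 4 _≡_mod_
  record _≡_mod_ (a b : ℤ) (c : ℕ) : Set where
    constructor _,_
    field
      quotient : ℤ
      equality : a ≡ b + quotient * + c

  module _ {c : ℕ} where

    ≡mod-refl : ∀ {a} → a ≡ a mod c
    ≡mod-refl {a} = + 0 , lemma a (+ c)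
      where lemma : ∀ a c → a ≡ a + + 0 * c
            lemma = solve-∀

    ≡⇒≡mod : ∀ {a b} → a ≡ b → a ≡ b mod c
    ≡⇒≡mod refl = ≡mod-refl

    ≡mod-sym : ∀ {a b} → a ≡ b mod c → b ≡ a mod c
    ≡mod-sym {a} {b} (k , a≡b+kc) = - k , trans (lemma b k (+ c)) (cong (_+ - k * + c) (sym a≡b+kc))
      where lemma : ∀ b k c → b ≡ (b + k * c) + - k * c
            lemma = solve-∀

    ≡mod-trans : ∀ {a b d} → a ≡ b mod c → b ≡ d mod c → a ≡ d mod c
    ≡mod-trans {a} {b} {d} (k , a≡b+kc) (l , b≡d+lc) =
      l + k , trans a≡b+kc (trans (cong (_+ k * + c) b≡d+lc) (lemma d l k (+ c)))
      where lemma : ∀ d l k c → d + l * c + k * c ≡ d + (l + k) * c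
            lemma = solve-∀

    ≡mod-+ʳ : ∀ {a b} t → a ≡ b mod c → a + t ≡ b + t mod c
    ≡mod-+ʳ {a} {b} t (k , a≡b+kc) = k , trans (cong (_+ t) a≡b+kc) (lemma b k t (+ c))
      where lemma : ∀ b k t c → b + k * c + t ≡ b + t + k * c
            lemma = solve-∀

    ≡mod-+ˡ : ∀ {a b} t → a ≡ b mod c → t + a ≡ t + b mod c
    ≡mod-+ˡ {a} {b} t (k , a≡b+kc) = k , trans (cong (_+_ t) a≡b+kc) (lemma b k t (+ c))
      where lemma : ∀ b k t c → t + (b + k * c) ≡ t + b + k * c
            lemma = solve-∀

    ≡mod-cancelˡ : ∀ {a b} t → t + a ≡ t + b mod c → a ≡ b mod c
    ≡mod-cancelˡ {a} {b} t t+a≡t+b =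
      subst₂ (λ u v → u ≡ v mod c) (lemma t a) (lemma t b) (≡mod-+ˡ (- t) t+a≡t+b)
      where lemma : ∀ t a → - t + (t + a) ≡ a
            lemma = solve-∀

    modulus≡0 : + c ≡ + 0 mod c
    modulus≡0 = + 1 , lemma (+ c)
      where lemma : ∀ c → c ≡ + 0 + + 1 * c
            lemma = solve-∀

    private
      ≢+positive-multiple : ∀ {r} r′ t → r < c → + r ≢ + r′ + +[1+ t ] * + c
      ≢+positive-multiple {r} r′ t r<c r≡r′+kc = ℕP.<⇒≱ r<c (begin
        c                   ≤⟨ ℕP.m≤m+n c (t ℕ.* c) ⟩
        suc t ℕ.* c         ≤⟨ ℕP.m≤n+m _ r′ ⟩
        r′ ℕ.+ suc t ℕ.* c  ≡⟨ ℤP.+-injective r′+kc≡r ⟩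
        r                   ∎)
        where
        open ℕP.≤-Reasoning
        r′+kc≡r : + (r′ ℕ.+ suc t ℕ.* c) ≡ + r
        r′+kc≡r = trans (ℤP.pos-+ r′ _) (trans (cong (_+_ (+ r′)) (ℤP.pos-* (suc t) c)) (sym r≡r′+kc))

    <-≡mod⇒≡ : ∀ {r r′} → r < c → r′ < c → + r ≡ + r′ mod c → r ≡ r′
    <-≡mod⇒≡ {r} {r′} _ _ (+ zero , r≡r′+0) = ℤP.+-injective (trans r≡r′+0 (lemma (+ r′) (+ c)))
      where lemma : ∀ a c → a + + 0 * c ≡ a
            lemma = solve-∀
    <-≡mod⇒≡ {r} {r′} r<c _ (+[1+ t ] , r≡r′+kc) = ⊥-elim (≢+positive-multiple r′ t r<c r≡r′+kc)
    <-≡mod⇒≡ {r} {r′} _ r′<c (-[1+ t ] , r≡r′-kc) = ⊥-elim (≢+positive-multiple r t r′<c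
      (sym (trans (cong (_+ +[1+ t ] * + c) r≡r′-kc) (lemma (+ r′) +[1+ t ] (+ c)))))
      where lemma : ∀ a t c → a + (- t) * c + t * c ≡ a
            lemma = solve-∀

module CyclicIndex where

  open import Data.Integer using (_+_; _*_; _/ℕ_)
  open Congruence

  idx-≡mod : ∀ {c} (h : 3 ≤ c) a → a ≡ + toℕ (idx c h a) mod c
  idx-≡mod {suc c} h a = a /ℕ suc c ,
    trans (a≡a%ℕn+[a/ℕn]*n a (suc c))
          (cong (λ r → + r + a /ℕ suc c * + suc c) (sym (toℕ-fromℕ< (n%ℕd<d a (suc c)))))

  idx-cong : ∀ {c} (h : 3 ≤ c) {a b} → a ≡ b mod c → idx c h a ≡ idx c h b
  idx-cong h {a} {b} a≡b = toℕ-injective (<-≡mod⇒≡ (toℕ<n _) (toℕ<n _)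
    (≡mod-trans (≡mod-sym (idx-≡mod h a)) (≡mod-trans a≡b (idx-≡mod h b))))

  idx-injective : ∀ {c} (h : 3 ≤ c) {a b} → idx c h a ≡ idx c h b → a ≡ b mod c
  idx-injective {c} h {a} {b} e =
    ≡mod-trans (idx-≡mod h a) (subst (λ i → + toℕ i ≡ b mod c) (sym e) (≡mod-sym (idx-≡mod h b)))

  idx-toℕ : ∀ {c} (h : 3 ≤ c) (i : Fin c) → idx c h (+ toℕ i) ≡ i
  idx-toℕ {suc c} h i = toℕ-injective (trans (toℕ-fromℕ< _) (ℕD.m<n⇒m%n≡m (toℕ<n i)))

module LabelledSunshine {m} (G : Graph m) {c} (h : 3 ≤ c) (x : Fin c → Fin m)
  (leaf : (i : Fin c) (j : ℕ) → j < deg G (x i) ∸ 2 → Fin m)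
  (cycle : IsCycleLab G c h x) (leaves : IsLeafLab G c x leaf) (connected : Connected G) where

  open import Data.Integer using (_+_; _*_; -_; _/ℕ_; _%ℕ_)
  open Congruence
  open CyclicIndex

  cy : ℤ → Fin m
  cy = cyc c h x

  x-injective : ∀ {i k} → x i ≡ x k → i ≡ k
  x-injective = proj₁ cycle

  cy-cong : ∀ {a b} → a ≡ b mod c → cy a ≡ cy b
  cy-cong a≡b = cong x (idx-cong h a≡b)

  cy-injective : ∀ {a b} → cy a ≡ cy b → a ≡ b mod c
  cy-injective e = idx-injective h (x-injective e)

  cy-toℕ : ∀ i → cy (+ toℕ i) ≡ x i
  cy-toℕ i = cong x (idx-toℕ h i)

  Adj-sym : ∀ {a b} → Adj G a b → Adj G b a
  Adj-sym {a} {b} e = trans (adj-sym G b a) e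

  OnCycle : Fin m → Set
  OnCycle a = ∃ λ i → x i ≡ a

  OffCycle : Fin m → Set
  OffCycle a = ∀ k → a ≢ x k

  off-cycle-unique-neighbour : ∀ {a b b′} → OffCycle a → Adj G a b → Adj G a b′ → b ≡ b′
  off-cycle-unique-neighbour {a} {b} {b′} off ab ab′ with b ≟ b′
  ... | yes b≡b′ = b≡b′
  ... | no b≢b′ =
    let (k , xk≡a) = Equivalence.to (proj₁ (proj₂ cycle) a) (two-neighbours⇒2≤deg G ab ab′ b≢b′)
    in ⊥-elim (off k (sym xk≡a))

  leaf-adj : ∀ i j p → Adj G (x i) (leaf i j p)
  leaf-adj = proj₁ leaves

  leaf-off-cycle : ∀ i j p → OffCycle (leaf i j p)
  leaf-off-cycle = proj₁ (proj₂ leaves)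

  leaf-injective : ∀ {i j p i′ j′ p′} → leaf i j p ≡ leaf i′ j′ p′ → i ≡ i′ × j ≡ j′
  leaf-injective = proj₁ (proj₂ (proj₂ leaves)) _ _ _ _ _ _

  leaf-cong : ∀ {i j p i′ j′ p′} → i ≡ i′ → j ≡ j′ → leaf i j p ≡ leaf i′ j′ p′
  leaf-cong {p = p} {p′ = p′} refl refl = cong (leaf _ _) (ℕP.<-irrelevant p p′)

  LabelledLeaf : Fin m → Set
  LabelledLeaf a = Σ (Fin c) λ i → Σ ℕ λ j → Σ (j < deg G (x i) ∸ 2) λ p → leaf i j p ≡ a

  -- A labelled leaf has no neighbour besides its cycle vertex, so a walk from
  -- an off-cycle vertex into the cycle reaches it through a single edge.
  reach-cycle⇒labelled-leaf : ∀ {a t} → Reach G a t → OnCycle t → OffCycle a → LabelledLeaf a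
  reach-cycle⇒labelled-leaf here (k , xk≡a) off = ⊥-elim (off k (sym xk≡a))
  reach-cycle⇒labelled-leaf {a} (step {b = b} ab walk) t-on off with any? (λ i → x i ≟ b)
  ... | yes (i , refl) = i , proj₂ (proj₂ (proj₂ leaves)) i a (Adj-sym ab) off
  ... | no b-on with reach-cycle⇒labelled-leaf walk t-on (λ k b≡xk → b-on (k , sym b≡xk))
  ...   | (i , j , p , refl) =
    ⊥-elim (off i (off-cycle-unique-neighbour (leaf-off-cycle i j p) (Adj-sym ab) (Adj-sym (leaf-adj i j p))))

  classify : ∀ a → OnCycle a ⊎ LabelledLeaf a
  classify a with any? (λ i → x i ≟ a)
  ... | yes on = inj₁ on
  ... | no off = inj₂ (reach-cycle⇒labelled-leaf (connected a (cy (+ 0))) (_ , refl) λ k a≡xk → off (k , sym a≡xk))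

  vertex-ind : (P : Fin m → Set) → (∀ i → P (x i)) → (∀ i j p → P (leaf i j p)) → ∀ a → P a
  vertex-ind P on-cycle on-leaf a with classify a
  ... | inj₁ (i , refl)         = on-cycle i
  ... | inj₂ (i , j , p , refl) = on-leaf i j p

  adj-x-leaf : ∀ k i j p → adj G (x k) (leaf i j p) ≡ does (k ≟ i)
  adj-x-leaf k i j p with k ≟ i
  ... | yes refl = leaf-adj i j p
  ... | no k≢i   = ¬-not λ e → k≢i (x-injective
    (off-cycle-unique-neighbour (leaf-off-cycle i j p) (Adj-sym e) (Adj-sym (leaf-adj i j p))))

  adj-leaf-leaf : ∀ i j p i′ j′ p′ → adj G (leaf i j p) (leaf i′ j′ p′) ≡ false
  adj-leaf-leaf i j p i′ j′ p′ = ¬-not λ e → leaf-off-cycle i′ j′ p′ i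
    (off-cycle-unique-neighbour (leaf-off-cycle i j p) e (Adj-sym (leaf-adj i j p)))

  shift : ℤ → Fin c → Fin c
  shift s i = idx c h (s + + toℕ i)

  shift-cong : ∀ {s t} i → s ≡ t mod c → shift s i ≡ shift t i
  shift-cong i s≡t = idx-cong h (≡mod-+ʳ _ s≡t)

  shift-0 : ∀ i → shift (+ 0) i ≡ i
  shift-0 = idx-toℕ h

  shift-∘ : ∀ s t i → shift t (shift s i) ≡ shift (t + s) i
  shift-∘ s t i = idx-cong h (≡mod-trans (≡mod-+ˡ t (≡mod-sym (idx-≡mod h (s + + toℕ i))))
                                         (≡⇒≡mod (sym (ℤP.+-assoc t s (+ toℕ i)))))

  shift-injective : ∀ s {i k} → shift s i ≡ shift s k → i ≡ k
  shift-injective s {i} {k} e =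
    trans (sym (idx-toℕ h i)) (trans (idx-cong h (≡mod-cancelˡ s (idx-injective h e))) (idx-toℕ h k))

  does-shift-≟ : ∀ s k i → does (shift s k ≟ shift s i) ≡ does (k ≟ i)
  does-shift-≟ s k i with shift s k ≟ shift s i | k ≟ i
  ... | yes _ | yes _    = refl
  ... | no _  | no _     = refl
  ... | yes e | no k≢i   = ⊥-elim (k≢i (shift-injective s e))
  ... | no ne | yes refl = ⊥-elim (ne refl)

  record DegPeriodic (s : ℤ) : Set where
    constructor degPeriodic
    field deg-cy-shift : ∀ a → deg G (cy (s + a)) ≡ deg G (cy a)
  open DegPeriodic

  deg-shift : ∀ {s} → DegPeriodic s → ∀ i → deg G (x (shift s i)) ≡ deg G (x i)
  deg-shift d i = trans (deg-cy-shift d (+ toℕ i)) (cong (deg G) (cy-toℕ i))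

  leaf-bound-shift : ∀ {s} → DegPeriodic s → ∀ i {j} → j < deg G (x i) ∸ 2 → j < deg G (x (shift s i)) ∸ 2
  leaf-bound-shift d i {j} = subst (λ e → j < e ∸ 2) (sym (deg-shift d i))

  degPeriodic-0 : DegPeriodic (+ 0)
  degPeriodic-0 = degPeriodic λ a → cong (deg G ∘ cy) (ℤP.+-identityˡ a)

  degPeriodic-+ : ∀ {s t} → DegPeriodic s → DegPeriodic t → DegPeriodic (t + s)
  degPeriodic-+ {s} {t} ds dt = degPeriodic λ a →
    trans (cong (deg G ∘ cy) (ℤP.+-assoc t s a)) (trans (deg-cy-shift dt (s + a)) (deg-cy-shift ds a))

  degPeriodic-neg : ∀ {s} → DegPeriodic s → DegPeriodic (- s)
  degPeriodic-neg {s} d = degPeriodic λ a →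
    trans (sym (deg-cy-shift d (- s + a))) (cong (deg G ∘ cy) (lemma s a))
    where lemma : ∀ s a → s + (- s + a) ≡ a
          lemma = solve-∀

  degPeriodic-* : ∀ {s} → DegPeriodic s → ∀ k → DegPeriodic (+ k * s)
  degPeriodic-* {s} d zero = subst DegPeriodic (sym (ℤP.*-zeroˡ s)) degPeriodic-0
  degPeriodic-* {s} d (suc k) = subst DegPeriodic (lemma s (+ k)) (degPeriodic-+ (degPeriodic-* d k) d)
    where lemma : ∀ s k → s + k * s ≡ (+ 1 + k) * s
          lemma = solve-∀

  rotate : (s : ℤ) → DegPeriodic s → Fin m → Fin m
  rotate s d a with classify a
  ... | inj₁ (i , _)         = x (shift s i)
  ... | inj₂ (i , j , p , _) = leaf (shift s i) j (leaf-bound-shift d i p)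

  rotate-x : ∀ s d i → rotate s d (x i) ≡ x (shift s i)
  rotate-x s d i with classify (x i)
  ... | inj₁ (i′ , xi′≡xi)   = cong (x ∘ shift s) (x-injective xi′≡xi)
  ... | inj₂ (i′ , j , p , e) = ⊥-elim (leaf-off-cycle i′ j p i e)

  rotate-leaf : ∀ s d i j p p′ → rotate s d (leaf i j p) ≡ leaf (shift s i) j p′
  rotate-leaf s d i j p p′ with classify (leaf i j p)
  ... | inj₁ (i′ , e)           = ⊥-elim (leaf-off-cycle i j p i′ (sym e))
  ... | inj₂ (i′ , j′ , p″ , e) with leaf-injective e
  ...   | refl , refl = leaf-cong refl refl

  rotate-cy : ∀ s d a → rotate s d (cy a) ≡ cy (s + a)
  rotate-cy s d a = trans (rotate-x s d _) (cy-cong (≡mod-+ˡ s (≡mod-sym (idx-≡mod h a))))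

  ≗-by-structure : (f g : Fin m → Fin m) → (∀ i → f (x i) ≡ g (x i)) →
                   (∀ i j p → f (leaf i j p) ≡ g (leaf i j p)) → ∀ a → f a ≡ g a
  ≗-by-structure f g = vertex-ind (λ a → f a ≡ g a)

  rotate-cong : ∀ {s t} ds dt → s ≡ t mod c → ∀ a → rotate s ds a ≡ rotate t dt a
  rotate-cong {s} {t} ds dt s≡t = ≗-by-structure (rotate s ds) (rotate t dt)
    (λ i → trans (rotate-x s ds i) (trans (cong x (shift-cong i s≡t)) (sym (rotate-x t dt i))))
    (λ i j p → trans (rotate-leaf s ds i j p (leaf-bound-shift ds i p))
       (trans (leaf-cong (shift-cong i s≡t) refl) (sym (rotate-leaf t dt i j p (leaf-bound-shift dt i p)))))

  rotate-0 : ∀ d a → rotate (+ 0) d a ≡ a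
  rotate-0 d = ≗-by-structure (rotate (+ 0) d) (λ a → a)
    (λ i → trans (rotate-x (+ 0) d i) (cong x (shift-0 i)))
    (λ i j p → trans (rotate-leaf (+ 0) d i j p (leaf-bound-shift d i p)) (leaf-cong (shift-0 i) refl))

  rotate-trivial : ∀ {s} d → s ≡ + 0 mod c → ∀ a → rotate s d a ≡ a
  rotate-trivial d s≡0 a = trans (rotate-cong d degPeriodic-0 s≡0 a) (rotate-0 degPeriodic-0 a)

  rotate-∘ : ∀ {s t} ds dt dts a → rotate t dt (rotate s ds a) ≡ rotate (t + s) dts a
  rotate-∘ {s} {t} ds dt dts = ≗-by-structure (λ a → rotate t dt (rotate s ds a)) (rotate (t + s) dts)
    (λ i → trans (cong (rotate t dt) (rotate-x s ds i))
         (trans (rotate-x t dt (shift s i)) (trans (cong x (shift-∘ s t i)) (sym (rotate-x (t + s) dts i)))))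
    (λ i j p → let p₁ = leaf-bound-shift ds i p in
      trans (cong (rotate t dt) (rotate-leaf s ds i j p p₁))
        (trans (rotate-leaf t dt (shift s i) j p₁ (leaf-bound-shift dt (shift s i) p₁))
          (trans (leaf-cong (shift-∘ s t i) refl) (sym (rotate-leaf (t + s) dts i j p (leaf-bound-shift dts i p))))))

  rotate-cancel : ∀ {s t} ds dt → t + s ≡ + 0 mod c → ∀ a → rotate t dt (rotate s ds a) ≡ a
  rotate-cancel ds dt t+s≡0 a = trans (rotate-∘ ds dt (degPeriodic-+ ds dt) a) (rotate-trivial _ t+s≡0 a)

  rotatePerm : (s : ℤ) → DegPeriodic s → Permutation′ m
  rotatePerm s d = permutation (rotate s d) (rotate (- s) (degPeriodic-neg d))
    (rotate-cancel (degPeriodic-neg d) d (≡⇒≡mod (ℤP.+-inverseʳ s)))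
    (rotate-cancel d (degPeriodic-neg d) (≡⇒≡mod (ℤP.+-inverseˡ s)))

  iter-rotatePerm : ∀ {s} d k a → iter (rotatePerm s d) k a ≡ rotate (+ k * s) (degPeriodic-* d k) a
  iter-rotatePerm {s} d zero a = sym (rotate-trivial _ (≡⇒≡mod (ℤP.*-zeroˡ s)) a)
  iter-rotatePerm {s} d (suc k) a = begin
    rotate s d (iter (rotatePerm s d) k a)            ≡⟨ cong (rotate s d) (iter-rotatePerm d k a) ⟩
    rotate s d (rotate (+ k * s) _ a)                 ≡⟨ rotate-∘ _ d (degPeriodic-+ (degPeriodic-* d k) d) a ⟩
    rotate (s + + k * s) _ a                          ≡⟨ rotate-cong _ _ (≡⇒≡mod (lemma s (+ k))) a ⟩
    rotate (+ suc k * s) (degPeriodic-* d (suc k)) a  ∎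
    where open ≡-Reasoning
          lemma : ∀ s k → s + k * s ≡ (+ 1 + k) * s
          lemma = solve-∀

  rotatePerm-order : ∀ {δ} d q → q ℕ.* δ ≡ c → ∀ a → iter (rotatePerm (+ δ) d) q a ≡ a
  rotatePerm-order {δ} d q qδ≡c a = trans (iter-rotatePerm d q a) (rotate-trivial _ qδ≡0 a)
    where qδ≡0 : + q * + δ ≡ + 0 mod c
          qδ≡0 = ≡mod-trans (≡⇒≡mod (trans (sym (ℤP.pos-* q δ)) (cong +_ qδ≡c))) modulus≡0

  record RotatesBy (π : Permutation′ m) (s : ℤ) : Set where
    constructor rotatesBy
    field
      isAut    : IsAut G π
      cy-shift : ∀ a → π ⟨$⟩ʳ cy a ≡ cy (s + a)

  rotatesBy⇒degPeriodic : ∀ {π s} → RotatesBy π s → DegPeriodic s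
  rotatesBy⇒degPeriodic {π} (rotatesBy aut rot) = degPeriodic λ a →
    trans (cong (deg G) (sym (rot a))) (aut-preserves-deg G π aut (cy a))

  rotatesBy-cong : ∀ {π s t} → s ≡ t mod c → RotatesBy π s → RotatesBy π t
  rotatesBy-cong s≡t (rotatesBy aut rot) = rotatesBy aut λ a → trans (rot a) (cy-cong (≡mod-+ʳ a s≡t))

  rotatesBy-∘ₚ : ∀ {π ψ s t} → RotatesBy π s → RotatesBy ψ t → RotatesBy (π ∘ₚ ψ) (t + s)
  rotatesBy-∘ₚ {π} {ψ} {s} {t} (rotatesBy autπ rotπ) (rotatesBy autψ rotψ) =
    rotatesBy (λ a b → trans (autπ a b) (autψ _ _))
    λ a → trans (cong (ψ ⟨$⟩ʳ_) (rotπ a)) (trans (rotψ (s + a)) (cong cy (sym (ℤP.+-assoc t s a))))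

  flip-isAut : ∀ {π} → IsAut G π → IsAut G (flip π)
  flip-isAut {π} aut a b = sym (trans (aut (π ⟨$⟩ˡ a) (π ⟨$⟩ˡ b)) (cong₂ (adj G) (inverseʳ π) (inverseʳ π)))

  -- On the cycle the canonical rotation agrees with π; every other adjacency is
  -- determined by the leaf labels alone.
  rotatePerm-isAut : ∀ {π s} → RotatesBy π s → ∀ d → IsAut G (rotatePerm s d)
  rotatePerm-isAut {π} {s} (rotatesBy aut rot) d =
    vertex-ind (λ a → ∀ b → Preserved a b)
      (λ k → vertex-ind (Preserved (x k)) (x-x k) (x-leaf k))
      (λ i j p → vertex-ind (Preserved (leaf i j p)) (leaf-x i j p) (leaf-leaf i j p))
    where
    Preserved : Fin m → Fin m → Set
    Preserved a b = adj G a b ≡ adj G (rotate s d a) (rotate s d b)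
    π≗rotate : ∀ i → π ⟨$⟩ʳ x i ≡ rotate s d (x i)
    π≗rotate i = trans (cong (π ⟨$⟩ʳ_) (sym (cy-toℕ i))) (trans (rot (+ toℕ i)) (sym (rotate-x s d i)))
    x-x : ∀ i k → Preserved (x i) (x k)
    x-x i k = trans (aut (x i) (x k)) (cong₂ (adj G) (π≗rotate i) (π≗rotate k))
    x-leaf : ∀ k i j p → Preserved (x k) (leaf i j p)
    x-leaf k i j p = let p′ = leaf-bound-shift d i p in begin
      adj G (x k) (leaf i j p)                              ≡⟨ adj-x-leaf k i j p ⟩
      does (k ≟ i)                                          ≡⟨ does-shift-≟ s k i ⟨
      does (shift s k ≟ shift s i)                          ≡⟨ adj-x-leaf (shift s k) (shift s i) j p′ ⟨
      adj G (x (shift s k)) (leaf (shift s i) j p′)         ≡⟨ cong₂ (adj G) (rotate-x s d k) (rotate-leaf s d i j p p′) ⟨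
      adj G (rotate s d (x k)) (rotate s d (leaf i j p))    ∎
      where open ≡-Reasoning
    leaf-x : ∀ i j p k → Preserved (leaf i j p) (x k)
    leaf-x i j p k = trans (adj-sym G _ _) (trans (x-leaf k i j p) (adj-sym G _ _))
    leaf-leaf : ∀ i j p i′ j′ p′ → Preserved (leaf i j p) (leaf i′ j′ p′)
    leaf-leaf i j p i′ j′ p′ = trans (adj-leaf-leaf i j p i′ j′ p′) (sym (trans
      (cong₂ (adj G) (rotate-leaf s d i j p (leaf-bound-shift d i p)) (rotate-leaf s d i′ j′ p′ (leaf-bound-shift d i′ p′)))
      (adj-leaf-leaf _ _ _ _ _ _)))

  flip-rotatesBy : ∀ {π s} → RotatesBy π s → RotatesBy (flip π) (- s)
  flip-rotatesBy {π} {s} (rotatesBy aut rot) = rotatesBy (flip-isAut {π} aut) λ a →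
    trans (cong (π ⟨$⟩ˡ_) (trans (cong cy (sym (lemma s a))) (sym (rot (- s + a))))) (inverseˡ π)
    where lemma : ∀ s a → s + (- s + a) ≡ a
          lemma = solve-∀

  A : ℤ → Set
  A = InA G c h x

  BoundsPositiveA : ℕ → Set
  BoundsPositiveA δ = ∀ β → A β → + 0 ℤ.< β → + δ ℤ.≤ β

  A⇒rotatesBy : ∀ {β} → A β → Σ (Permutation′ m) λ π → RotatesBy π β
  A⇒rotatesBy (π , (aut , α , rot) , xβ≡πx₀) = π , rotatesBy-cong α≡β (rotatesBy aut rot)
    where α≡β : α ≡ _ mod c
          α≡β = ≡mod-sym (≡mod-trans (cy-injective (trans xβ≡πx₀ (rot (+ 0)))) (≡⇒≡mod (ℤP.+-identityʳ α)))

  rotatesBy⇒A : ∀ {π β} → RotatesBy π β → A β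
  rotatesBy⇒A {π} {β} (rotatesBy aut rot) =
    π , (aut , β , rot) , trans (cong cy (sym (ℤP.+-identityʳ β))) (sym (rot (+ 0)))

  A-cong : ∀ {β γ} → β ≡ γ mod c → A β → A γ
  A-cong β≡γ Aβ = rotatesBy⇒A (rotatesBy-cong β≡γ (proj₂ (A⇒rotatesBy Aβ)))

  A-+ : ∀ {β γ} → A β → A γ → A (γ + β)
  A-+ Aβ Aγ = rotatesBy⇒A (rotatesBy-∘ₚ (proj₂ (A⇒rotatesBy Aβ)) (proj₂ (A⇒rotatesBy Aγ)))

  A-neg : ∀ {β} → A β → A (- β)
  A-neg Aβ = rotatesBy⇒A (flip-rotatesBy (proj₂ (A⇒rotatesBy Aβ)))

  A-0 : A (+ 0)
  A-0 = rotatesBy⇒A {idₚ} (rotatesBy (λ a b → refl) λ a → cong cy (sym (ℤP.+-identityˡ a)))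

  A-modulus : A (+ c)
  A-modulus = A-cong (≡mod-sym modulus≡0) A-0

  A-* : ∀ {β} → A β → ∀ q → A (q * β)
  A-* {β} Aβ (+ q)    = A-*ℕ q
    where A-*ℕ : ∀ k → A (+ k * β)
          A-*ℕ zero    = subst A (sym (ℤP.*-zeroˡ β)) A-0
          A-*ℕ (suc k) = subst A (lemma β (+ k)) (A-+ (A-*ℕ k) Aβ)
            where lemma : ∀ β k → β + k * β ≡ (+ 1 + k) * β
                  lemma = solve-∀
  A-* {β} Aβ -[1+ q ] = subst A (ℤP.neg-distribˡ-* (+ suc q) β) (A-neg (A-* Aβ (+ suc q)))

  A-below-minimum : ∀ {δ} → BoundsPositiveA δ → ∀ {r} → r < δ → A (+ r) → r ≡ 0
  A-below-minimum minimal {zero}  _   _  = refl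
  A-below-minimum minimal {suc r} r<δ Ar with minimal (+ suc r) Ar (ℤ.+<+ ℕ.z<s)
  ... | ℤ.+≤+ δ≤r = ⊥-elim (ℕP.<⇒≱ r<δ δ≤r)

  -- The remainder of β modulo δ lies in A, so minimality forces it to vanish.
  minimum-divides : ∀ δ .{{_ : ℕ.NonZero δ}} → A (+ δ) → BoundsPositiveA δ → ∀ β → A β → + δ ∣ β
  minimum-divides δ Aδ minimal β Aβ = ℕ∣.divides ℤ.∣ β /ℕ δ ∣ (begin
    ℤ.∣ β ∣                     ≡⟨ cong ℤ.∣_∣ β≡qδ ⟩
    ℤ.∣ β /ℕ δ * + δ ∣          ≡⟨ ℤP.abs-* (β /ℕ δ) (+ δ) ⟩
    ℤ.∣ β /ℕ δ ∣ ℕ.* δ          ∎)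
    where
    open ≡-Reasoning
    β≡r+qδ : β ≡ + (β %ℕ δ) + β /ℕ δ * + δ
    β≡r+qδ = a≡a%ℕn+[a/ℕn]*n β δ
    A-remainder : A (+ (β %ℕ δ))
    A-remainder = subst A (trans (cong (_+ - (β /ℕ δ) * + δ) β≡r+qδ) (lemma (+ (β %ℕ δ)) (β /ℕ δ) (+ δ)))
                          (A-+ (A-* Aδ (- (β /ℕ δ))) Aβ)
      where lemma : ∀ r q d → r + q * d + - q * d ≡ r
            lemma = solve-∀
    β≡qδ : β ≡ β /ℕ δ * + δ
    β≡qδ = trans β≡r+qδ (trans (cong (λ r → + r + β /ℕ δ * + δ) (A-below-minimum minimal (n%ℕd<d β δ) A-remainder))
                               (ℤP.+-identityˡ _))

  nontrivial-rotation⇒A-element : (Σ (Permutation′ m) λ π → IsRotation G c h x π × π ⟨$⟩ʳ cy (+ 0) ≢ cy (+ 0)) →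
                                  Σ ℕ λ b → 0 < b × b < c × A (+ b)
  nontrivial-rotation⇒A-element (π , (aut , α , rot) , moves-x₀) =
    toℕ (idx c h α) , ℕP.n≢0⇒n>0 b≢0 , toℕ<n _ , A-cong (idx-≡mod h α) (rotatesBy⇒A {π} (rotatesBy aut rot))
    where
    b≢0 : toℕ (idx c h α) ≢ 0
    b≢0 b≡0 = moves-x₀ (trans (rot (+ 0)) (trans (cy-cong (≡mod-trans (≡⇒≡mod (ℤP.+-identityʳ α)) (idx-≡mod h α)))
                                                   (cong (cy ∘ +_) b≡0)))

  -- With a rotation by 1 all cycle vertices would have the degree of x₀.
  A-excludes-1 : ∀ {ν} → deg G (x ν) ≡ 2 → 0 < deg G (cy (+ 0)) ∸ 2 → ¬ A (+ 1)
  A-excludes-1 {ν} deg-xν≡2 x₀-has-leaf A1 =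
    ℕP.<-irrefl refl (subst (λ e → 0 < e ∸ 2) x₀-deg≡2 x₀-has-leaf)
    where
    d : DegPeriodic (+ 1)
    d = rotatesBy⇒degPeriodic (proj₂ (A⇒rotatesBy A1))
    deg-constant : ∀ k → deg G (cy (+ k)) ≡ deg G (cy (+ 0))
    deg-constant zero    = refl
    deg-constant (suc k) = trans (deg-cy-shift d (+ k)) (deg-constant k)
    x₀-deg≡2 : deg G (cy (+ 0)) ≡ 2
    x₀-deg≡2 = trans (sym (deg-constant (toℕ ν))) (trans (cong (deg G) (cy-toℕ ν)) deg-xν≡2)

open import Data.Nat using (_*_)

lemma5p5 : (n : ℕ) (U T : Graph (suc n)) (Up : Graph (suc (suc n)))
    (w v : Fin (suc (suc n))) (c : ℕ) (h : 3 ≤ c) (x : Fin c → Fin (suc (suc n)))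
    (ν : Fin c)
    (leaf : (i : Fin c) (j : ℕ) → j < deg Up (x i) ∸ 2 → Fin (suc (suc n))) →
    Sunshine U → Caterpillar T → DeckMeetAtLeast 5 U T →
    Sunshine Up → ValidWV U T Up w v →
    IsCycleLab Up c h x →
    Adj Up (cyc c h x (+ 0)) w →
    x ν ≡ v →
    deg Up (cyc c h x (+ toℕ ν ℤ.+ + 1)) ≤ deg Up (cyc c h x (+ toℕ ν ℤ.- + 1)) →
    IsLeafLab Up c x leaf →
    (Σ (0 < deg Up (cyc c h x (+ 0)) ∸ 2) λ p → leaf (idx c h (+ 0)) 0 p ≡ w) →
    (∀ (U′ : Graph (suc (suc n))) (w′ v′ : Fin (suc (suc n))) →
       Sunshine U′ → ValidWV U T U′ w′ v′ →
       ∀ k → ChiAtLeast U′ w′ v′ k → ChiAtLeast Up w v k) →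
    (Σ (Perm (suc (suc n))) λ π →
       IsRotation Up c h x π × π ⟨$⟩ʳ cyc c h x (+ 0) ≢ cyc c h x (+ 0)) →
    (δ : ℕ) → 0 < δ → InA Up c h x (+ δ) →
    (∀ β → InA Up c h x β → ℤ.+ 0 ℤ.< β → + δ ℤ.≤ β) →
    (∀ β → InA Up c h x β → + δ ∣ β)
    × (2 ≤ δ × 2 * δ ≤ c)
    × (Σ (Perm (suc (suc n))) λ φ →
         IsRotation Up c h x φ
         × (Σ ℕ λ q → q * δ ≡ c × (∀ a → iter φ q a ≡ a))
         × (∀ (i : ℤ) → φ ⟨$⟩ʳ cyc c h x i ≡ cyc c h x (+ δ ℤ.+ i))
         × (∀ (i : Fin c) (j : ℕ) (p : j < deg Up (x i) ∸ 2)
              (p′ : j < deg Up (cyc c h x (+ δ ℤ.+ + toℕ i)) ∸ 2) →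
              φ ⟨$⟩ʳ leaf i j p ≡ leaf (idx c h (+ δ ℤ.+ + toℕ i)) j p′))
lemma5p5 n U T Up w v c h x ν leaf _ _ _ (connected , _) (_ , _ , _ , deg-v≡2) cycle _ xν≡v _ leaves
         (x₀-has-leaf , _) _ nontrivial δ 0<δ Aδ minimal =
  δ∣A , (2≤δ , ∣∧<⇒2*≤ δ∣c δ<c) ,
  φ , (rotatePerm-isAut r d , + δ , rotate-cy (+ δ) d) , (q , sym c≡qδ , rotatePerm-order d q (sym c≡qδ)) ,
  rotate-cy (+ δ) d , rotate-leaf (+ δ) d
  where
  open LabelledSunshine Up h x leaf cycle leaves connected
  instance
    δ-nonZero : ℕ.NonZero δ
    δ-nonZero = ℕ.>-nonZero 0<δ
  δ∣A : ∀ β → A β → + δ ∣ β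
  δ∣A = minimum-divides δ Aδ minimal
  δ∣c : δ ℕ∣.∣ c
  δ∣c = δ∣A (+ c) A-modulus
  q : ℕ
  q = ℕ∣._∣_.quotient δ∣c
  c≡qδ : c ≡ q * δ
  c≡qδ = ℕ∣._∣_.equality δ∣c
  r : RotatesBy (proj₁ (A⇒rotatesBy Aδ)) (+ δ)
  r = proj₂ (A⇒rotatesBy Aδ)
  d : DegPeriodic (+ δ)
  d = rotatesBy⇒degPeriodic r
  φ : Perm (suc (suc n))
  φ = rotatePerm (+ δ) d
  δ<c : δ < c
  δ<c = let (b , 0<b , b<c , Ab) = nontrivial-rotation⇒A-element nontrivial
        in ℕP.≤-<-trans (ℤP.drop‿+≤+ (minimal (+ b) Ab (ℤ.+<+ 0<b))) b<c
  2≤δ : 2 ≤ δ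
  2≤δ = ℕP.≤∧≢⇒< 0<δ λ 1≡δ →
    A-excludes-1 (trans (cong (deg Up) xν≡v) deg-v≡2) x₀-has-leaf (subst (A ∘ +_) (sym 1≡δ) Aδ)
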